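{- For every $\varepsilon>0$ there is a constant $C_\varepsilon$ such that for all $M\ge1$, $$\sum_{m=1}^M\prod_{p\mid m}\frac{3}{p}\le C_\varepsilon M^{\varepsilon},$$ where the product is over primes dividing $m$.
   Formalization: The parameter ε ranges over the positive rationals. -}

module Defs where

open import Data.Nat as ℕ using (ℕ; zero; suc)
open import Data.Nat.Divisibility using (_∣?_)
open import Data.Nat.Primality using (prime?)
open import Data.List using (List; filter; upTo; map; foldr)
open import Data.Integer using (+_)
open import Data.Rational using (ℚ; 0ℚ; 1ℚ; _+_; _*_; _/_)
open import Relation.Nullary.Decidable using (_×-dec_)

-- primes p with p ∣ m, enumerated among 0,1,…,m (for m ≥ 1 every prime divisor is ≤ m)
primeDivisors : ℕ → List ℕ
primeDivisors m = filter (λ p → prime? p ×-dec (p ∣? m)) (upTo (suc m))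

-- the factor 3/p (p = 0 never occurs, since 0 is not prime)
threeOver : ℕ → ℚ
threeOver zero    = 1ℚ
threeOver (suc k) = + 3 / suc k

sumℚ : List ℚ → ℚ
sumℚ = foldr _+_ 0ℚ

prodℚ : List ℚ → ℚ
prodℚ = foldr _*_ 1ℚ

f : ℕ → ℚ
f m = prodℚ (map threeOver (primeDivisors m))

S : ℕ → ℚ
S M = sumℚ (map (λ i → f (suc i)) (upTo M))

_^ℚ_ : ℚ → ℕ → ℚ
q ^ℚ zero  = 1ℚ
q ^ℚ suc n = q * (q ^ℚ n)

module Submission where

-- Write Φ_q(M) (roughSum q M below) for the sum of f over the q-rough m ≤ M, so that S = Φ₂.
-- Splitting off the exact power of q dividing m gives
--   Φ_q(M) ≤ Φ_{q+1}(M) + ∑_{k ≥ 1} (3/q) Φ_{q+1}(⌊M/q^k⌋).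
-- For ε = 1/N the role of M^ε is played by the rational weight w(n) = ∏_{2 ≤ j ≤ n} (1 + 1/(K j)),
-- K = 2N: w is supermultiplicative, w(n)^N ≤ n, and u = 1/w telescopes: (3/q) u(q) = 3K (u(q-1) - u(q)).
-- For q above a threshold Q₀ this yields Φ_q(M) ≤ 2 w(M) by strong induction on M, and each of the
-- finitely many steps from Q₀ down to 2 costs a constant factor.  Hence S(M)^N ≤ C^N M, and larger
-- exponents (a+1)/N follow since M ≥ 1.

open import Data.Nat using (ℕ)
open import Defs

module RationalLemmas where

  open import Data.Nat as ℕ using (ℕ; zero; suc; z≤n; s≤s; NonZero)
  import Data.Nat.Properties as ℕ
  import Data.Integer as ℤ
  import Data.Integer.Properties as ℤ
  open import Data.Rational as ℚ using (ℚ; mkℚ; 0ℚ; 1ℚ; _+_; _*_; _-_; _≤_; _/_; 1/_; *≤*)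
  open import Data.Rational.Properties
  import Data.Nat.Coprimality as Coprime
  open import Data.Maybe using (Maybe; just; nothing)
  open import Level using (0ℓ)
  open import Relation.Binary.PropositionalEquality using (_≡_; refl; sym; trans; cong; cong₂; subst₂; module ≡-Reasoning)
  open import Relation.Nullary.Decidable using (yes; no)
  open import Tactic.RingSolver using (solve-∀)
  open import Tactic.RingSolver.Core.AlmostCommutativeRing using (AlmostCommutativeRing; fromCommutativeRing)
  open import Algebra.Bundles using (CommutativeMonoid)
  open import Algebra.Properties.CommutativeSemigroup (CommutativeMonoid.commutativeSemigroup *-1-commutativeMonoid) public
    using (x∙yz≈y∙xz; x∙yz≈xz∙y; xy∙z≈xz∙y; xy∙z≈x∙zy; xy∙z≈y∙xz) renaming (interchange to *-interchange)

  ℚ-ring : AlmostCommutativeRing 0ℓ 0ℓ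
  ℚ-ring = fromCommutativeRing +-*-commutativeRing 0≟
    where
    0≟ : ∀ x → Maybe (0ℚ ≡ x)
    0≟ x with 0ℚ ≟ x
    ... | yes 0≡x = just 0≡x
    ... | no _    = nothing

  0≤1 : 0ℚ ≤ 1ℚ
  0≤1 = *≤* (ℤ.+≤+ z≤n)

  +-nonNeg : ∀ {p q} → 0ℚ ≤ p → 0ℚ ≤ q → 0ℚ ≤ p + q
  +-nonNeg = +-mono-≤

  *-monoˡ-≤-0≤ : ∀ {r p q} → 0ℚ ≤ r → p ≤ q → r * p ≤ r * q
  *-monoˡ-≤-0≤ {r} 0≤r = *-monoˡ-≤-nonNeg r {{ℚ.nonNegative 0≤r}}

  *-monoʳ-≤-0≤ : ∀ {r p q} → 0ℚ ≤ r → p ≤ q → p * r ≤ q * r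
  *-monoʳ-≤-0≤ {r} 0≤r = *-monoʳ-≤-nonNeg r {{ℚ.nonNegative 0≤r}}

  *-nonNeg : ∀ {p q} → 0ℚ ≤ p → 0ℚ ≤ q → 0ℚ ≤ p * q
  *-nonNeg {p} 0≤p 0≤q = ≤-trans (≤-reflexive (sym (*-zeroʳ p))) (*-monoˡ-≤-0≤ 0≤p 0≤q)

  *-mono-≤-0≤ : ∀ {p q r s} → 0ℚ ≤ p → 0ℚ ≤ r → p ≤ q → r ≤ s → p * r ≤ q * s
  *-mono-≤-0≤ 0≤p 0≤r p≤q r≤s = ≤-trans (*-monoʳ-≤-0≤ 0≤r p≤q) (*-monoˡ-≤-0≤ (≤-trans 0≤p p≤q) r≤s)

  p-q≤p : ∀ p {q} → 0ℚ ≤ q → p - q ≤ p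
  p-q≤p p 0≤q = ≤-trans (+-monoʳ-≤ p (neg-antimono-≤ 0≤q)) (≤-reflexive (+-identityʳ p))

  p≤p+q : ∀ p {q} → 0ℚ ≤ q → p ≤ p + q
  p≤p+q p 0≤q = ≤-trans (≤-reflexive (sym (+-identityʳ p))) (+-monoʳ-≤ p 0≤q)

  p≤q+p : ∀ p {q} → 0ℚ ≤ q → p ≤ q + p
  p≤q+p p {q} 0≤q = ≤-trans (p≤p+q p 0≤q) (≤-reflexive (+-comm p q))

  inverse-unique : ∀ a {x y} → a * x ≡ 1ℚ → a * y ≡ 1ℚ → x ≡ y
  inverse-unique a {x} {y} ax≡1 ay≡1 = begin
    x           ≡⟨ sym (*-identityʳ x) ⟩
    x * 1ℚ      ≡⟨ cong (x *_) (sym ay≡1) ⟩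
    x * (a * y) ≡⟨ sym (*-assoc x a y) ⟩
    x * a * y   ≡⟨ cong (_* y) (trans (*-comm x a) ax≡1) ⟩
    1ℚ * y      ≡⟨ *-identityˡ y ⟩
    y           ∎
    where open ≡-Reasoning

  inverse-antitone : ∀ {a b x y} → 0ℚ ≤ x → 0ℚ ≤ y → a * x ≡ 1ℚ → b * y ≡ 1ℚ → a ≤ b → y ≤ x
  inverse-antitone {a} {b} {x} {y} 0≤x 0≤y ax≡1 by≡1 a≤b = begin
    y               ≡⟨ sym (*-identityˡ y) ⟩
    1ℚ * y          ≡⟨ cong (_* y) (trans (sym ax≡1) (*-comm a x)) ⟩
    x * a * y       ≤⟨ *-monoʳ-≤-0≤ 0≤y (*-monoˡ-≤-0≤ 0≤x a≤b) ⟩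
    x * b * y       ≡⟨ trans (*-assoc x b y) (cong (x *_) by≡1) ⟩
    x * 1ℚ          ≡⟨ *-identityʳ x ⟩
    x               ∎
    where open ≤-Reasoning

  fromℕ : ℕ → ℚ
  fromℕ n = mkℚ (ℤ.+ n) 0 (Coprime.sym (Coprime.1-coprimeTo n))

  n/1≡fromℕ : ∀ n → ℤ.+ n / 1 ≡ fromℕ n
  n/1≡fromℕ n = ↥p/↧p≡p (fromℕ n)

  fromℕ-+ : ∀ m n → fromℕ (m ℕ.+ n) ≡ fromℕ m + fromℕ n
  fromℕ-+ m n = sym (trans (/-cong {p₂ = ℤ.+ (m ℕ.+ n)} {q₂ = 1} numerator refl) (n/1≡fromℕ (m ℕ.+ n)))
    where
    numerator : ℤ.+ m ℤ.* ℤ.+ 1 ℤ.+ ℤ.+ n ℤ.* ℤ.+ 1 ≡ ℤ.+ (m ℕ.+ n)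
    numerator = cong₂ ℤ._+_ (ℤ.*-identityʳ (ℤ.+ m)) (ℤ.*-identityʳ (ℤ.+ n))

  fromℕ-* : ∀ m n → fromℕ (m ℕ.* n) ≡ fromℕ m * fromℕ n
  fromℕ-* m n = sym (trans (/-cong {p₂ = ℤ.+ (m ℕ.* n)} {q₂ = 1} (sym (ℤ.pos-* m n)) refl) (n/1≡fromℕ (m ℕ.* n)))

  fromℕ-suc : ∀ n → fromℕ (suc n) ≡ 1ℚ + fromℕ n
  fromℕ-suc = fromℕ-+ 1

  fromℕ-mono-≤ : ∀ {m n} → m ℕ.≤ n → fromℕ m ≤ fromℕ n
  fromℕ-mono-≤ {m} {n} m≤n =
    *≤* (subst₂ ℤ._≤_ (sym (ℤ.*-identityʳ (ℤ.+ m))) (sym (ℤ.*-identityʳ (ℤ.+ n))) (ℤ.+≤+ m≤n))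

  fromℕ-nonNeg : ∀ n → 0ℚ ≤ fromℕ n
  fromℕ-nonNeg n = fromℕ-mono-≤ z≤n

  -- recip 0 = 0 is a junk value; every use has a nonzero argument.
  recip : ℕ → ℚ
  recip zero    = 0ℚ
  recip (suc n) = 1/ fromℕ (suc n)

  fromℕ*recip : ∀ n .{{_ : NonZero n}} → fromℕ n * recip n ≡ 1ℚ
  fromℕ*recip (suc n) = *-inverseʳ (fromℕ (suc n))

  recip-nonNeg : ∀ n → 0ℚ ≤ recip n
  recip-nonNeg zero    = ≤-refl
  recip-nonNeg (suc n) = *≤* (ℤ.+≤+ z≤n)

  recip-antitone : ∀ {m n} .{{_ : NonZero m}} .{{_ : NonZero n}} → m ℕ.≤ n → recip n ≤ recip m
  recip-antitone {m} {n} m≤n =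
    inverse-antitone (recip-nonNeg m) (recip-nonNeg n) (fromℕ*recip m) (fromℕ*recip n) (fromℕ-mono-≤ m≤n)

  recip-* : ∀ m n .{{_ : NonZero m}} .{{_ : NonZero n}} →
            recip (m ℕ.* n) ≡ recip m * recip n
  recip-* m n = inverse-unique (fromℕ (m ℕ.* n)) (fromℕ*recip (m ℕ.* n) {{ℕ.m*n≢0 m n}}) (begin
    fromℕ (m ℕ.* n) * (recip m * recip n)       ≡⟨ cong (_* (recip m * recip n)) (fromℕ-* m n) ⟩
    fromℕ m * fromℕ n * (recip m * recip n)     ≡⟨ *-interchange (fromℕ m) (fromℕ n) (recip m) (recip n) ⟩
    fromℕ m * recip m * (fromℕ n * recip n)     ≡⟨ cong₂ _*_ (fromℕ*recip m) (fromℕ*recip n) ⟩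
    1ℚ                                          ∎)
    where open ≡-Reasoning

  n*recip[m*n]≡recip[m] : ∀ m n .{{_ : NonZero m}} .{{_ : NonZero n}} → fromℕ n * recip (m ℕ.* n) ≡ recip m
  n*recip[m*n]≡recip[m] m n = begin
    fromℕ n * recip (m ℕ.* n)       ≡⟨ cong (fromℕ n *_) (recip-* m n) ⟩
    fromℕ n * (recip m * recip n)   ≡⟨ x∙yz≈y∙xz (fromℕ n) (recip m) (recip n) ⟩
    recip m * (fromℕ n * recip n)   ≡⟨ cong (recip m *_) (fromℕ*recip n) ⟩
    recip m * 1ℚ                    ≡⟨ *-identityʳ (recip m) ⟩
    recip m                         ∎
    where open ≡-Reasoning

  threeOver-nonNeg : ∀ p → 0ℚ ≤ threeOver p
  threeOver-nonNeg zero    = 0≤1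
  threeOver-nonNeg (suc p) = nonNegative⁻¹ _ {{normalize-nonNeg 3 (suc p)}}

  threeOver-suc : ∀ p → threeOver (suc p) ≡ fromℕ 3 * recip (suc p)
  threeOver-suc p = sym (/-cong {p₁ = ℤ.+ 3 ℤ.* ℤ.+ 1} {q₁ = 1 ℕ.* suc p} refl (ℕ.*-identityˡ (suc p)))

  threeOver-≤3 : ∀ p → threeOver p ≤ fromℕ 3
  threeOver-≤3 zero    = fromℕ-mono-≤ (s≤s z≤n)
  threeOver-≤3 (suc p) = begin
    threeOver (suc p)         ≡⟨ threeOver-suc p ⟩
    fromℕ 3 * recip (suc p)   ≤⟨ *-monoˡ-≤-0≤ (fromℕ-nonNeg 3) (recip-antitone {1} {suc p} (s≤s z≤n)) ⟩
    fromℕ 3 * 1ℚ              ≡⟨ *-identityʳ (fromℕ 3) ⟩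
    fromℕ 3                   ∎
    where open ≤-Reasoning

  ^ℚ-nonNeg : ∀ {x} n → 0ℚ ≤ x → 0ℚ ≤ x ^ℚ n
  ^ℚ-nonNeg zero    0≤x = 0≤1
  ^ℚ-nonNeg (suc n) 0≤x = *-nonNeg 0≤x (^ℚ-nonNeg n 0≤x)

  ^ℚ-mono-≤ : ∀ {x y} n → 0ℚ ≤ x → x ≤ y → x ^ℚ n ≤ y ^ℚ n
  ^ℚ-mono-≤ zero    0≤x x≤y = ≤-refl
  ^ℚ-mono-≤ (suc n) 0≤x x≤y = *-mono-≤-0≤ 0≤x (^ℚ-nonNeg n 0≤x) x≤y (^ℚ-mono-≤ n 0≤x x≤y)

  ^ℚ-distrib-* : ∀ x y n → (x * y) ^ℚ n ≡ x ^ℚ n * y ^ℚ n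
  ^ℚ-distrib-* x y zero    = refl
  ^ℚ-distrib-* x y (suc n) = trans (cong (x * y *_) (^ℚ-distrib-* x y n)) (*-interchange x y (x ^ℚ n) (y ^ℚ n))

  1^ℚn≡1 : ∀ n → 1ℚ ^ℚ n ≡ 1ℚ
  1^ℚn≡1 zero    = refl
  1^ℚn≡1 (suc n) = trans (*-identityˡ (1ℚ ^ℚ n)) (1^ℚn≡1 n)

  1≤x⇒x≤x^ℚ[1+n] : ∀ {x} n → 1ℚ ≤ x → x ≤ x ^ℚ suc n
  1≤x⇒x≤x^ℚ[1+n] {x} n 1≤x = begin
    x            ≡⟨ sym (*-identityʳ x) ⟩
    x * 1ℚ       ≡⟨ cong (x *_) (sym (1^ℚn≡1 n)) ⟩
    x * 1ℚ ^ℚ n  ≤⟨ *-monoˡ-≤-0≤ (≤-trans 0≤1 1≤x) (^ℚ-mono-≤ n 0≤1 1≤x) ⟩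
    x ^ℚ suc n   ∎
    where open ≤-Reasoning

  bernoulli : ∀ {x} n → 0ℚ ≤ x → 1ℚ + fromℕ n * x ≤ (1ℚ + x) ^ℚ n
  bernoulli {x} zero    0≤x = ≤-reflexive (trans (cong (1ℚ +_) (*-zeroˡ x)) (+-identityʳ 1ℚ))
  bernoulli {x} (suc n) 0≤x = begin
    1ℚ + fromℕ (suc n) * x                    ≡⟨ cong (λ t → 1ℚ + t * x) (fromℕ-suc n) ⟩
    1ℚ + (1ℚ + fromℕ n) * x                   ≤⟨ p≤p+q _ (*-nonNeg (*-nonNeg (fromℕ-nonNeg n) 0≤x) 0≤x) ⟩
    1ℚ + (1ℚ + fromℕ n) * x + fromℕ n * x * x ≡⟨ expand (fromℕ n) x ⟩
    (1ℚ + x) * (1ℚ + fromℕ n * x)             ≤⟨ *-monoˡ-≤-0≤ (+-nonNeg 0≤1 0≤x) (bernoulli n 0≤x) ⟩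
    (1ℚ + x) ^ℚ suc n                         ∎
    where
    open ≤-Reasoning
    expand : ∀ a y → 1ℚ + (1ℚ + a) * y + a * y * y ≡ (1ℚ + y) * (1ℚ + a * y)
    expand = solve-∀ ℚ-ring

  -- The form of (1 + x)ⁿ ≤ 1 / (1 - n x) that needs no division.
  bernoulli-upper : ∀ {x} n → 0ℚ ≤ x → (1ℚ + x) ^ℚ n * (1ℚ - fromℕ n * x) ≤ 1ℚ
  bernoulli-upper {x} zero    0≤x = ≤-reflexive (cancel x)
    where
    cancel : ∀ y → 1ℚ * (1ℚ - 0ℚ * y) ≡ 1ℚ
    cancel = solve-∀ ℚ-ring
  bernoulli-upper {x} (suc n) 0≤x = begin
    (1ℚ + x) * P * (1ℚ - fromℕ (suc n) * x)                  ≡⟨ cong (λ t → (1ℚ + x) * P * (1ℚ - t * x)) (fromℕ-suc n) ⟩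
    (1ℚ + x) * P * (1ℚ - (1ℚ + fromℕ n) * x)                 ≡⟨ expand x P (fromℕ n) ⟩
    P * (1ℚ - fromℕ n * x) - P * ((1ℚ + fromℕ n) * x * x)    ≤⟨ p-q≤p _ (*-nonNeg P-nonNeg (*-nonNeg (*-nonNeg 1+n-nonNeg 0≤x) 0≤x)) ⟩
    P * (1ℚ - fromℕ n * x)                                   ≤⟨ bernoulli-upper n 0≤x ⟩
    1ℚ                                                       ∎
    where
    open ≤-Reasoning
    P : ℚ
    P = (1ℚ + x) ^ℚ n
    P-nonNeg : 0ℚ ≤ P
    P-nonNeg = ^ℚ-nonNeg n (+-nonNeg 0≤1 0≤x)
    1+n-nonNeg : 0ℚ ≤ 1ℚ + fromℕ n
    1+n-nonNeg = +-nonNeg 0≤1 (fromℕ-nonNeg n)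
    expand : ∀ y p a → (1ℚ + y) * p * (1ℚ - (1ℚ + a) * y) ≡ p * (1ℚ - a * y) - p * ((1ℚ + a) * y * y)
    expand = solve-∀ ℚ-ring

  sumTo : (ℕ → ℚ) → ℕ → ℚ
  sumTo h zero    = 0ℚ
  sumTo h (suc L) = sumTo h L + h (suc L)

  sumTo-nonNeg : ∀ {h} L → (∀ k → 0ℚ ≤ h k) → 0ℚ ≤ sumTo h L
  sumTo-nonNeg zero    0≤h = ≤-refl
  sumTo-nonNeg (suc L) 0≤h = +-nonNeg (sumTo-nonNeg L 0≤h) (0≤h (suc L))

  sumTo-mono-≤ : ∀ {g h} L → (∀ k → .{{NonZero k}} → k ℕ.≤ L → g k ≤ h k) → sumTo g L ≤ sumTo h L
  sumTo-mono-≤ zero    g≤h = ≤-refl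
  sumTo-mono-≤ (suc L) g≤h = +-mono-≤ (sumTo-mono-≤ L λ k k≤L → g≤h k (ℕ.m≤n⇒m≤1+n k≤L)) (g≤h (suc L) ℕ.≤-refl)

  sumTo-cong : ∀ {g h} L → (∀ k → g k ≡ h k) → sumTo g L ≡ sumTo h L
  sumTo-cong zero    g≡h = refl
  sumTo-cong (suc L) g≡h = cong₂ _+_ (sumTo-cong L g≡h) (g≡h (suc L))

  sumTo-+ : ∀ g h L → sumTo (λ k → g k + h k) L ≡ sumTo g L + sumTo h L
  sumTo-+ g h zero    = refl
  sumTo-+ g h (suc L) = trans (cong (_+ (g (suc L) + h (suc L))) (sumTo-+ g h L))
                              (interchange (sumTo g L) (sumTo h L) (g (suc L)) (h (suc L)))
    where
    interchange : ∀ a b c d → a + b + (c + d) ≡ a + c + (b + d)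
    interchange = solve-∀ ℚ-ring

  sumTo-*ˡ : ∀ c h L → sumTo (λ k → c * h k) L ≡ c * sumTo h L
  sumTo-*ˡ c h zero    = sym (*-zeroʳ c)
  sumTo-*ˡ c h (suc L) = trans (cong (_+ c * h (suc L)) (sumTo-*ˡ c h L)) (sym (*-distribˡ-+ c (sumTo h L) (h (suc L))))

  sumTo-0ℚ : ∀ L → sumTo (λ _ → 0ℚ) L ≡ 0ℚ
  sumTo-0ℚ zero    = refl
  sumTo-0ℚ (suc L) = trans (+-identityʳ _) (sumTo-0ℚ L)

  sumTo-swap : ∀ (a : ℕ → ℕ → ℚ) M L →
               sumTo (λ m → sumTo (a m) L) M ≡ sumTo (λ k → sumTo (λ m → a m k) M) L
  sumTo-swap a zero    L = sym (sumTo-0ℚ L)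
  sumTo-swap a (suc M) L = begin
    sumTo (λ m → sumTo (a m) L) M + sumTo (a (suc M)) L                   ≡⟨ cong (_+ sumTo (a (suc M)) L) (sumTo-swap a M L) ⟩
    sumTo (λ k → sumTo (λ m → a m k) M) L + sumTo (a (suc M)) L           ≡⟨ sym (sumTo-+ _ _ L) ⟩
    sumTo (λ k → sumTo (λ m → a m k) M + a (suc M) k) L                   ∎
    where open ≡-Reasoning

  term≤sumTo : ∀ {h} L {k} → (∀ j → 0ℚ ≤ h j) → .{{NonZero k}} → k ℕ.≤ L → h k ≤ sumTo h L
  term≤sumTo zero {suc k} 0≤h ()
  term≤sumTo {h} (suc L) {k} 0≤h k≤1+L with k ℕ.≟ suc L
  ... | yes refl = ≤-trans (≤-reflexive (sym (+-identityˡ (h (suc L))))) (+-monoˡ-≤ (h (suc L)) (sumTo-nonNeg L 0≤h))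
  ... | no k≢1+L = ≤-trans (term≤sumTo L 0≤h (ℕ.≤-pred (ℕ.≤∧≢⇒< k≤1+L k≢1+L))) (p≤p+q (sumTo h L) (0≤h (suc L)))

  geometric-≤ : ∀ {x c} L → 0ℚ ≤ x → 0ℚ ≤ c → x * (1ℚ + c) ≤ c → sumTo (x ^ℚ_) L ≤ c
  geometric-≤ {x} {c} L 0≤x 0≤c x[1+c]≤c = ≤-trans (p≤p+q _ (*-nonNeg 0≤c (^ℚ-nonNeg L 0≤x))) (invariant L)
    where
    invariant : ∀ L → sumTo (x ^ℚ_) L + c * x ^ℚ L ≤ c
    invariant zero    = ≤-reflexive (trans (+-identityˡ _) (*-identityʳ c))
    invariant (suc L) = begin
      s + x * p + c * (x * p)  ≡⟨ regroup s x p c ⟩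
      s + x * (1ℚ + c) * p     ≤⟨ +-monoʳ-≤ s (*-monoʳ-≤-0≤ (^ℚ-nonNeg L 0≤x) x[1+c]≤c) ⟩
      s + c * p                ≤⟨ invariant L ⟩
      c                        ∎
      where
      open ≤-Reasoning
      s p : ℚ
      s = sumTo (x ^ℚ_) L
      p = x ^ℚ L
      regroup : ∀ s x p c → s + x * p + c * (x * p) ≡ s + x * (1ℚ + c) * p
      regroup = solve-∀ ℚ-ring

  geometric-≤-2x : ∀ {x} L → 0ℚ ≤ x → fromℕ 2 * x ≤ 1ℚ → sumTo (x ^ℚ_) L ≤ fromℕ 2 * x
  geometric-≤-2x {x} L 0≤x 2x≤1 = geometric-≤ L 0≤x (*-nonNeg (fromℕ-nonNeg 2) 0≤x) (begin
    x * (1ℚ + fromℕ 2 * x)     ≡⟨ *-distribˡ-+ x 1ℚ (fromℕ 2 * x) ⟩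
    x * 1ℚ + x * (fromℕ 2 * x) ≤⟨ +-monoʳ-≤ (x * 1ℚ) (*-monoˡ-≤-0≤ 0≤x 2x≤1) ⟩
    x * 1ℚ + x * 1ℚ            ≡⟨ double x ⟩
    fromℕ 2 * x                ∎)
    where
    open ≤-Reasoning
    double : ∀ y → y * 1ℚ + y * 1ℚ ≡ fromℕ 2 * y
    double = solve-∀ ℚ-ring

module Divisors where

  open import Data.Nat
  open import Data.Nat.Properties
  open import Data.Nat.Divisibility
  open import Data.Nat.DivMod
  open import Data.Nat.Primality
  open import Data.List using ([]; _∷_; [_]; _++_; filter; upTo; map)
  open import Data.List.Properties using (upTo-∷ʳ; filter-++; filter-accept; filter-reject; filter-none; ++-identityʳ)
  open import Data.List.Relation.Unary.All.Properties using (applyUpTo⁺₁)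
  open import Data.Product using (_×_; _,_; proj₂; ∃-syntax)
  open import Data.Sum using (_⊎_; inj₁; inj₂)
  open import Function using (_∘_; it)
  open import Induction.WellFounded using (Acc; acc)
  open import Data.Nat.Induction using (<-wellFounded)
  open import Level using (0ℓ)
  open import Relation.Binary.PropositionalEquality using (_≡_; _≢_; refl; sym; trans; cong; cong₂; subst; module ≡-Reasoning)
  open import Relation.Nullary using (Dec; contradiction)
  import Relation.Nullary.Decidable as Dec
  open import Relation.Nullary.Decidable using (yes; no; ¬?; _×-dec_)
  open import Relation.Unary using (Pred; Decidable)
  import Data.Rational as ℚ

  rough? : ∀ q n → Dec (q Rough n)
  rough? q n = ¬? (Dec.map′ toDivisor fromDivisor (anyUpTo? (λ d → nonTrivial? d ×-dec d ∣? n) q))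
    where
    toDivisor : ∃[ d ] d < q × NonTrivial d × d ∣ n → n HasNonTrivialDivisorLessThan q
    toDivisor (d , d<q , nt , d∣n) = hasNonTrivialDivisor {{nt}} d<q d∣n
    fromDivisor : n HasNonTrivialDivisorLessThan q → ∃[ d ] d < q × NonTrivial d × d ∣ n
    fromDivisor (hasNonTrivialDivisor {d} {{nt}} d<q d∣n) = d , d<q , Dec.recompute (nonTrivial? d) nt , d∣n

  filter-upTo-suc : ∀ {P : Pred ℕ 0ℓ} (P? : Decidable P) n →
                    filter P? (upTo (suc n)) ≡ filter P? (upTo n) ++ filter P? [ n ]
  filter-upTo-suc P? n = trans (cong (filter P?) (sym (upTo-∷ʳ n))) (filter-++ P? (upTo n) [ n ])

  filter-upTo-none : ∀ {P : Pred ℕ 0ℓ} (P? : Decidable P) n → (∀ {x} → P x → n ≤ x) → filter P? (upTo n) ≡ []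
  filter-upTo-none P? n n≤ = filter-none P? (applyUpTo⁺₁ _ n (λ x<n Px → <⇒≱ x<n (n≤ Px)))

  filter-upTo-bounded : ∀ {P : Pred ℕ 0ℓ} (P? : Decidable P) {n n′} → n ≤ n′ → (∀ {x} → P x → x < n) →
                        filter P? (upTo n′) ≡ filter P? (upTo n)
  filter-upTo-bounded P? {n′ = zero}  z≤n   <n = refl
  filter-upTo-bounded P? {n} {suc n′} n≤1+n′ <n with m≤n⇒m<n∨m≡n n≤1+n′
  ... | inj₂ refl  = refl
  ... | inj₁ n<1+n′ = begin
    filter P? (upTo (suc n′))             ≡⟨ filter-upTo-suc P? n′ ⟩
    filter P? (upTo n′) ++ filter P? [ n′ ] ≡⟨ cong (filter P? (upTo n′) ++_) (filter-reject P? (λ Pn′ → <⇒≱ (<n Pn′) (≤-pred n<1+n′))) ⟩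
    filter P? (upTo n′) ++ []             ≡⟨ ++-identityʳ _ ⟩
    filter P? (upTo n′)                   ≡⟨ filter-upTo-bounded P? (≤-pred n<1+n′) <n ⟩
    filter P? (upTo n)                    ∎
    where open ≡-Reasoning

  module _ {P R : Pred ℕ 0ℓ} (P? : Decidable P) (R? : Decidable R) {q : ℕ}
           (P⇒≡∨R : ∀ {x} → P x → x ≡ q ⊎ R x) (R⇒P : ∀ {x} → R x → P x) (Pq : P q) (R⇒q< : ∀ {x} → R x → q < x) where

    P⇒R : ∀ {x} → q < x → P x → R x
    P⇒R q<x Px with P⇒≡∨R Px
    ... | inj₁ refl = contradiction q<x (<-irrefl refl)
    ... | inj₂ Rx   = Rx

    filter-upTo-insert : ∀ n → q < n → filter P? (upTo n) ≡ q ∷ filter R? (upTo n)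
    filter-upTo-insert (suc n) (s≤s q≤n) with m≤n⇒m<n∨m≡n q≤n
    ... | inj₂ refl = begin
      filter P? (upTo (suc q))               ≡⟨ filter-upTo-suc P? q ⟩
      filter P? (upTo q) ++ filter P? [ q ]  ≡⟨ cong₂ _++_ (filter-upTo-none P? q P⇒q≤) (filter-accept P? Pq) ⟩
      [ q ]                                  ≡⟨ cong (q ∷_) (sym (filter-upTo-none R? (suc q) R⇒q<)) ⟩
      q ∷ filter R? (upTo (suc q))           ∎
      where
      open ≡-Reasoning
      P⇒q≤ : ∀ {x} → P x → q ≤ x
      P⇒q≤ Px with P⇒≡∨R Px
      ... | inj₁ refl = ≤-refl
      ... | inj₂ Rx   = <⇒≤ (R⇒q< Rx)
    ... | inj₁ q<n = begin
      filter P? (upTo (suc n))                    ≡⟨ filter-upTo-suc P? n ⟩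
      filter P? (upTo n) ++ filter P? [ n ]       ≡⟨ cong₂ _++_ (filter-upTo-insert n q<n) last ⟩
      q ∷ (filter R? (upTo n) ++ filter R? [ n ]) ≡⟨ cong (q ∷_) (sym (filter-upTo-suc R? n)) ⟩
      q ∷ filter R? (upTo (suc n))                ∎
      where
      open ≡-Reasoning
      last : filter P? [ n ] ≡ filter R? [ n ]
      last with R? n
      ... | yes Rn = filter-accept P? (R⇒P Rn)
      ... | no ¬Rn = filter-reject P? (¬Rn ∘ P⇒R q<n)

  prime∣q^k*m⇒∣m : ∀ {p q m} k → Prime p → Prime q → p ≢ q → p ∣ q ^ k * m → p ∣ m
  prime∣q^k*m⇒∣m {p} {q} {m} zero    _  _  _   p∣m = subst (p ∣_) (*-identityˡ m) p∣m
  prime∣q^k*m⇒∣m {p} {q} {m} (suc k) pp pq p≢q p∣n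
    with euclidsLemma q (q ^ k * m) pp (subst (p ∣_) (*-assoc q (q ^ k) m) p∣n)
  ... | inj₂ p∣rest = prime∣q^k*m⇒∣m k pp pq p≢q p∣rest
  ... | inj₁ p∣q with prime⇒irreducible pq p∣q
  ...   | inj₁ refl = contradiction pp ¬prime[1]
  ...   | inj₂ p≡q  = contradiction p≡q p≢q

  rough⇒divisor-≥ : ∀ {q m d} → q Rough m → NonTrivial d → d ∣ m → q ≤ d
  rough⇒divisor-≥ rough nt d∣m = ≮⇒≥ λ d<q → rough (hasNonTrivialDivisor {{nt}} d<q d∣m)

  primeDivisors-q^k*m : ∀ {q m} k → Prime q → .{{NonZero m}} → suc q Rough m →
                        primeDivisors (q ^ suc k * m) ≡ q ∷ primeDivisors m
  primeDivisors-q^k*m {q} {m} k pq rough = begin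
    filter P? (upTo (suc n))      ≡⟨ filter-upTo-insert P? R? P⇒≡∨R R⇒P (pq , q∣n) R⇒q< (suc n) (s≤s q≤n) ⟩
    q ∷ filter R? (upTo (suc n))  ≡⟨ cong (q ∷_) (filter-upTo-bounded R? (s≤s m≤n) (s≤s ∘ ∣⇒≤ ∘ proj₂)) ⟩
    q ∷ filter R? (upTo (suc m))  ∎
    where
    open ≡-Reasoning
    n : ℕ
    n = q ^ suc k * m
    instance
      q≢0 : NonZero q
      q≢0 = prime⇒nonZero pq
      n≢0 : NonZero n
      n≢0 = m*n≢0 (q ^ suc k) m {{m^n≢0 q (suc k)}}
    P? : Decidable (λ p → Prime p × p ∣ n)
    P? = λ p → prime? p ×-dec (p ∣? n)
    R? : Decidable (λ p → Prime p × p ∣ m)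
    R? = λ p → prime? p ×-dec (p ∣? m)
    m∣n : m ∣ n
    m∣n = n∣m*n (q ^ suc k)
    q∣n : q ∣ n
    q∣n = ∣-trans (m∣m*n (q ^ k)) (m∣m*n m)
    q≤n : q ≤ n
    q≤n = ∣⇒≤ q∣n
    m≤n : m ≤ n
    m≤n = ∣⇒≤ m∣n
    P⇒≡∨R : ∀ {x} → Prime x × x ∣ n → x ≡ q ⊎ Prime x × x ∣ m
    P⇒≡∨R {x} (px , x∣n) with x ≟ q
    ... | yes x≡q = inj₁ x≡q
    ... | no x≢q  = inj₂ (px , prime∣q^k*m⇒∣m (suc k) px pq x≢q x∣n)
    R⇒P : ∀ {x} → Prime x × x ∣ m → Prime x × x ∣ n
    R⇒P (px , x∣m) = px , ∣-trans x∣m m∣n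
    R⇒q< : ∀ {x} → Prime x × x ∣ m → q < x
    R⇒q< (px , x∣m) = rough⇒divisor-≥ rough (prime⇒nonTrivial px) x∣m

  f-q^k*m : ∀ {q m} k → Prime q → .{{NonZero m}} → suc q Rough m →
            f (q ^ suc k * m) ≡ threeOver q ℚ.* f m
  f-q^k*m k pq rough = cong (prodℚ ∘ map threeOver) (primeDivisors-q^k*m k pq rough)

  [1+M]/d-cases : ∀ M d .{{_ : NonZero d}} →
                  (d ∣ suc M × suc M / d ≡ suc (M / d)) ⊎ (d ∤ suc M × suc M / d ≡ M / d)
  [1+M]/d-cases M d with suc (M % d) ≟ d
  ... | yes 1+r≡d = inj₁ (divides (suc (M / d)) 1+M≡[1+k]d , trans (/-congˡ 1+M≡[1+k]d) (m*n/n≡m (suc (M / d)) d))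
    where
    1+M≡[1+k]d : suc M ≡ suc (M / d) * d
    1+M≡[1+k]d = trans (cong suc (m≡m%n+[m/n]*n M d)) (cong (_+ M / d * d) 1+r≡d)
  ... | no 1+r≢d = inj₂ (d∤1+M , (begin
    suc M / d                             ≡⟨ /-congˡ 1+M≡1+r+kd ⟩
    (suc (M % d) + M / d * d) / d         ≡⟨ +-distrib-/-∣ʳ (suc (M % d)) (n∣m*n (M / d)) ⟩
    suc (M % d) / d + M / d * d / d       ≡⟨ cong₂ _+_ (m<n⇒m/n≡0 1+r<d) (m*n/n≡m (M / d) d) ⟩
    M / d                                 ∎))
    where
    open ≡-Reasoning
    1+r<d : suc (M % d) < d
    1+r<d = ≤∧≢⇒< (m%n<n M d) 1+r≢d
    1+M≡1+r+kd : suc M ≡ suc (M % d) + M / d * d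
    1+M≡1+r+kd = cong suc (m≡m%n+[m/n]*n M d)
    d∤1+M : d ∤ suc M
    d∤1+M d∣1+M = <⇒≱ 1+r<d (∣⇒≤ d∣1+r)
      where
      d∣1+r : d ∣ suc (M % d)
      d∣1+r = ∣m+n∣m⇒∣n (subst (d ∣_) (trans 1+M≡1+r+kd (+-comm (suc (M % d)) (M / d * d))) d∣1+M) (n∣m*n (M / d))

  n<q^n : ∀ q .{{_ : NonTrivial q}} n → n < q ^ n
  n<q^n q zero    = s≤s z≤n
  n<q^n q (suc n) = begin-strict
    suc n      ≤⟨ n<q^n q n ⟩
    q ^ n      <⟨ m<m*n (q ^ n) q (nonTrivial⇒n>1 q) ⟩
    q ^ n * q  ≡⟨ *-comm (q ^ n) q ⟩
    q ^ suc n  ∎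
    where
    open ≤-Reasoning
    instance
      q^n≢0 : NonZero (q ^ n)
      q^n≢0 = m^n≢0 q n {{nonTrivial⇒nonZero q}}

  q-adic-split : ∀ q .{{_ : NonTrivial q}} n .{{_ : NonZero n}} → ∃[ k ] ∃[ m ] n ≡ q ^ k * m × q ∤ m
  q-adic-split q n = split n (<-wellFounded n)
    where
    split : ∀ n .{{_ : NonZero n}} → Acc _<_ n → ∃[ k ] ∃[ m ] n ≡ q ^ k * m × q ∤ m
    split n (acc smaller) with q ∣? n
    ... | no q∤n = 0 , n , sym (*-identityˡ n) , q∤n
    ... | yes (divides n′ n≡n′q) with split n′ {{n′≢0}} (smaller n′<n)
      where
      n′≢0 : NonZero n′
      n′≢0 = m*n≢0⇒m≢0 n′ {{subst NonZero n≡n′q it}}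
      n′<n : n′ < n
      n′<n = subst (n′ <_) (sym n≡n′q) (m<m*n n′ q {{n′≢0}} (nonTrivial⇒n>1 q))
    ...   | k , m , n′≡q^km , q∤m = suc k , m , (begin
      n              ≡⟨ n≡n′q ⟩
      n′ * q         ≡⟨ *-comm n′ q ⟩
      q * n′         ≡⟨ cong (q *_) n′≡q^km ⟩
      q * (q ^ k * m) ≡⟨ sym (*-assoc q (q ^ k) m) ⟩
      q ^ suc k * m  ∎) , q∤m
      where open ≡-Reasoning

module RoughSums where

  open import Data.Nat as ℕ using (ℕ; zero; suc; NonZero; NonTrivial)
  open import Data.Nat.Divisibility using (_∣_; _∣?_; hasNonTrivialDivisor)
  import Data.Nat.Properties as ℕ
  import Data.Nat.DivMod as ℕ
  import Data.Nat.Divisibility as ℕ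
  open import Data.Nat.Primality using (_Rough_; 2-rough; ∤⇒rough-suc; rough∧∣⇒rough; rough∧∣⇒prime)
  open import Data.List using ([]; _∷_; [_]; _++_; map; upTo)
  open import Data.List.Properties using (upTo-∷ʳ; map-++)
  open import Data.Product using (_,_)
  open import Data.Sum using (inj₁; inj₂)
  open import Data.Rational as ℚ using (ℚ; 0ℚ; 1ℚ; _+_; _*_; _≤_)
  open import Data.Rational.Properties
  open import Relation.Binary.PropositionalEquality using (_≡_; refl; sym; trans; cong; cong₂; subst; module ≡-Reasoning)
  open import Relation.Nullary using (Dec; yes; no; ¬_; contradiction)
  open import Function using (it; _∘_)
  open RationalLemmas
  open Divisors

  onlyIf : ∀ {A : Set} → Dec A → ℚ → ℚ
  onlyIf (yes _) x = x
  onlyIf (no _)  _ = 0ℚ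

  onlyIf-yes : ∀ {A : Set} (d : Dec A) {x} → A → onlyIf d x ≡ x
  onlyIf-yes (yes _) a = refl
  onlyIf-yes (no ¬a) a = contradiction a ¬a

  onlyIf-no : ∀ {A : Set} (d : Dec A) {x} → ¬ A → onlyIf d x ≡ 0ℚ
  onlyIf-no (yes a) ¬a = contradiction a ¬a
  onlyIf-no (no _)  ¬a = refl

  onlyIf-nonNeg : ∀ {A : Set} (d : Dec A) {x} → 0ℚ ≤ x → 0ℚ ≤ onlyIf d x
  onlyIf-nonNeg (yes _) 0≤x = 0≤x
  onlyIf-nonNeg (no _)  0≤x = ≤-refl

  onlyIf-≤ : ∀ {A : Set} (d : Dec A) {x} → 0ℚ ≤ x → onlyIf d x ≤ x
  onlyIf-≤ (yes _) 0≤x = ≤-refl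
  onlyIf-≤ (no _)  0≤x = 0≤x

  sumTo-multiples : ∀ h d .{{_ : NonZero d}} M →
                    sumTo (λ n → onlyIf (d ∣? n) (h (n ℕ./ d))) M ≡ sumTo h (M ℕ./ d)
  sumTo-multiples h d zero    = cong (sumTo h) (sym (ℕ.0/n≡0 d))
  sumTo-multiples h d (suc M) with [1+M]/d-cases M d
  ... | inj₁ (d∣1+M , [1+M]/d≡1+M/d) = begin
    sumTo _ M + onlyIf (d ∣? suc M) (h (suc M ℕ./ d)) ≡⟨ cong₂ _+_ (sumTo-multiples h d M) (onlyIf-yes (d ∣? suc M) d∣1+M) ⟩
    sumTo h (M ℕ./ d) + h (suc M ℕ./ d)               ≡⟨ cong (λ i → sumTo h (M ℕ./ d) + h i) [1+M]/d≡1+M/d ⟩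
    sumTo h (suc (M ℕ./ d))                           ≡⟨ cong (sumTo h) (sym [1+M]/d≡1+M/d) ⟩
    sumTo h (suc M ℕ./ d)                             ∎
    where open ≡-Reasoning
  ... | inj₂ (d∤1+M , [1+M]/d≡M/d) = begin
    sumTo _ M + onlyIf (d ∣? suc M) (h (suc M ℕ./ d)) ≡⟨ cong₂ _+_ (sumTo-multiples h d M) (onlyIf-no (d ∣? suc M) d∤1+M) ⟩
    sumTo h (M ℕ./ d) + 0ℚ                            ≡⟨ +-identityʳ _ ⟩
    sumTo h (M ℕ./ d)                                 ≡⟨ cong (sumTo h) (sym [1+M]/d≡M/d) ⟩
    sumTo h (suc M ℕ./ d)                             ∎
    where open ≡-Reasoning

  f-nonNeg : ∀ n → 0ℚ ≤ f n
  f-nonNeg n = prod-nonNeg (primeDivisors n)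
    where
    prod-nonNeg : ∀ ps → 0ℚ ≤ prodℚ (map threeOver ps)
    prod-nonNeg []       = 0≤1
    prod-nonNeg (p ∷ ps) = *-nonNeg (threeOver-nonNeg p) (prod-nonNeg ps)

  roughPart : ℕ → ℕ → ℚ
  roughPart q n = onlyIf (rough? q n) (f n)

  roughSum : ℕ → ℕ → ℚ
  roughSum q = sumTo (roughPart q)

  roughPart-nonNeg : ∀ q n → 0ℚ ≤ roughPart q n
  roughPart-nonNeg q n = onlyIf-nonNeg (rough? q n) (f-nonNeg n)

  roughSum-nonNeg : ∀ q M → 0ℚ ≤ roughSum q M
  roughSum-nonNeg q M = sumTo-nonNeg M (roughPart-nonNeg q)

  sumℚ-++-[] : ∀ xs y → sumℚ (xs ++ [ y ]) ≡ sumℚ xs + y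
  sumℚ-++-[] []       y = trans (+-identityʳ y) (sym (+-identityˡ y))
  sumℚ-++-[] (x ∷ xs) y = trans (cong (x +_) (sumℚ-++-[] xs y)) (sym (+-assoc x (sumℚ xs) y))

  sumℚ-upTo : ∀ h M → sumℚ (map (h ∘ suc) (upTo M)) ≡ sumTo h M
  sumℚ-upTo h zero    = refl
  sumℚ-upTo h (suc M) = begin
    sumℚ (map (h ∘ suc) (upTo (suc M)))            ≡⟨ cong (sumℚ ∘ map (h ∘ suc)) (sym (upTo-∷ʳ M)) ⟩
    sumℚ (map (h ∘ suc) (upTo M ++ [ M ]))         ≡⟨ cong sumℚ (map-++ (h ∘ suc) (upTo M) [ M ]) ⟩
    sumℚ (map (h ∘ suc) (upTo M) ++ [ h (suc M) ]) ≡⟨ sumℚ-++-[] (map (h ∘ suc) (upTo M)) (h (suc M)) ⟩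
    sumℚ (map (h ∘ suc) (upTo M)) + h (suc M)      ≡⟨ cong (_+ h (suc M)) (sumℚ-upTo h M) ⟩
    sumTo h (suc M)                                ∎
    where open ≡-Reasoning

  S≡roughSum-2 : ∀ M → S M ≡ roughSum 2 M
  S≡roughSum-2 M = trans (sumℚ-upTo f M) (sumTo-cong M λ n → sym (onlyIf-yes (rough? 2 n) 2-rough))

  S-nonNeg : ∀ M → 0ℚ ≤ S M
  S-nonNeg M = ≤-trans (roughSum-nonNeg 2 M) (≤-reflexive (sym (S≡roughSum-2 M)))

  roughSum-≤1 : ∀ q M → M ℕ.< q → roughSum q M ≤ 1ℚ
  roughSum-≤1 q zero            _   = 0≤1
  roughSum-≤1 q (suc zero)      _   = ≤-trans (≤-reflexive (+-identityˡ _)) (onlyIf-≤ (rough? q 1) (f-nonNeg 1))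
  roughSum-≤1 q (suc M@(suc _)) M<q = begin
    roughSum q M + roughPart q (suc M) ≡⟨ cong (roughSum q M +_) (onlyIf-no (rough? q (suc M)) not-rough) ⟩
    roughSum q M + 0ℚ                  ≡⟨ +-identityʳ _ ⟩
    roughSum q M                       ≤⟨ roughSum-≤1 q M (ℕ.<⇒≤ M<q) ⟩
    1ℚ                                 ∎
    where
    open ≤-Reasoning
    not-rough : ¬ q Rough suc M
    not-rough rough = rough (hasNonTrivialDivisor M<q ℕ.∣-refl)

  module Recurrence (q : ℕ) .{{_ : NonTrivial q}} where

    instance
      q≢0 : NonZero q
      q≢0 = ℕ.nonTrivial⇒nonZero q

    _/q^_ : ℕ → ℕ → ℕ
    n /q^ k = (n ℕ./ q ℕ.^ k) {{ℕ.m^n≢0 q k}}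

    primePowerPart : ℕ → ℕ → ℚ
    primePowerPart n k = threeOver q * onlyIf (q ℕ.^ k ∣? n) (roughPart (suc q) (n /q^ k))

    primePowerPart-nonNeg : ∀ n k → 0ℚ ≤ primePowerPart n k
    primePowerPart-nonNeg n k = *-nonNeg (threeOver-nonNeg q) (onlyIf-nonNeg (q ℕ.^ k ∣? n) (roughPart-nonNeg (suc q) _))

    -- A q-rough n is either (q+1)-rough, or n = q^k m with q prime, k ≥ 1 and m (q+1)-rough,
    -- and then f n = (3/q) f m.
    roughPart-split : ∀ {n L} .{{_ : NonZero n}} → n ℕ.≤ L →
                      roughPart q n ≤ roughPart (suc q) n + sumTo (primePowerPart n) L
    roughPart-split {n} {L} n≤L with rough? q n
    ... | no _        = +-nonNeg (roughPart-nonNeg (suc q) n) (sumTo-nonNeg L (primePowerPart-nonNeg n))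
    ... | yes q-rough = byDivisibility (q ∣? n)
      where
      open ≤-Reasoning
      byDivisibility : Dec (q ∣ n) → f n ≤ roughPart (suc q) n + sumTo (primePowerPart n) L
      byDivisibility (no q∤n) = begin
        f n                                              ≡⟨ sym (onlyIf-yes (rough? (suc q) n) (∤⇒rough-suc q∤n q-rough)) ⟩
        roughPart (suc q) n                              ≤⟨ p≤p+q _ (sumTo-nonNeg L (primePowerPart-nonNeg n)) ⟩
        roughPart (suc q) n + sumTo (primePowerPart n) L ∎
      byDivisibility (yes q∣n) with q-adic-split q n
      ... | zero , m , n≡m , q∤m = contradiction (subst (q ∣_) (trans n≡m (ℕ.*-identityˡ m)) q∣n) q∤m
      ... | k@(suc k-1) , m , n≡q^km , q∤m = begin
        f n                                              ≡⟨ cong f n≡q^km ⟩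
        f (q ℕ.^ k ℕ.* m)                                ≡⟨ f-q^k*m k-1 (rough∧∣⇒prime q-rough q∣n) m-rough ⟩
        threeOver q * f m                                ≡⟨ cong (threeOver q *_) (sym m-part) ⟩
        primePowerPart n k                               ≤⟨ term≤sumTo L (primePowerPart-nonNeg n) k≤L ⟩
        sumTo (primePowerPart n) L                       ≤⟨ p≤q+p _ (roughPart-nonNeg (suc q) n) ⟩
        roughPart (suc q) n + sumTo (primePowerPart n) L ∎
        where
        instance
          q^k≢0 : NonZero (q ℕ.^ k)
          q^k≢0 = ℕ.m^n≢0 q k
          m≢0 : NonZero m
          m≢0 = ℕ.m*n≢0⇒n≢0 (q ℕ.^ k) {{subst NonZero n≡q^km it}}
        n≡mq^k : n ≡ m ℕ.* q ℕ.^ k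
        n≡mq^k = trans n≡q^km (ℕ.*-comm (q ℕ.^ k) m)
        m-rough : suc q Rough m
        m-rough = ∤⇒rough-suc q∤m (rough∧∣⇒rough q-rough (ℕ.divides (q ℕ.^ k) n≡q^km))
        m-part : onlyIf (q ℕ.^ k ∣? n) (roughPart (suc q) (n /q^ k)) ≡ f m
        m-part = begin-equality
          onlyIf (q ℕ.^ k ∣? n) (roughPart (suc q) (n /q^ k)) ≡⟨ onlyIf-yes (q ℕ.^ k ∣? n) (ℕ.divides m n≡mq^k) ⟩
          roughPart (suc q) (n /q^ k)                         ≡⟨ cong (roughPart (suc q)) (trans (ℕ./-congˡ {o = q ℕ.^ k} n≡mq^k) (ℕ.m*n/n≡m m (q ℕ.^ k))) ⟩
          roughPart (suc q) m                                 ≡⟨ onlyIf-yes (rough? (suc q) m) m-rough ⟩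
          f m                                                 ∎
        k≤L : k ℕ.≤ L
        k≤L = ℕ.≤-trans (ℕ.<⇒≤ (n<q^n q k)) (ℕ.≤-trans (ℕ.∣⇒≤ (ℕ.divides m n≡mq^k)) n≤L)

    roughSum-recurrence : ∀ M → roughSum q M ≤ roughSum (suc q) M + sumTo (λ k → threeOver q * roughSum (suc q) (M /q^ k)) M
    roughSum-recurrence M = begin
      sumTo (roughPart q) M                                                        ≤⟨ sumTo-mono-≤ M (λ n n≤M → roughPart-split n≤M) ⟩
      sumTo (λ n → roughPart (suc q) n + sumTo (primePowerPart n) M) M             ≡⟨ sumTo-+ _ _ M ⟩
      roughSum (suc q) M + sumTo (λ n → sumTo (primePowerPart n) M) M              ≡⟨ cong (roughSum (suc q) M +_) (sumTo-swap primePowerPart M M) ⟩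
      roughSum (suc q) M + sumTo (λ k → sumTo (λ n → primePowerPart n k) M) M      ≡⟨ cong (roughSum (suc q) M +_) (sumTo-cong M multiples) ⟩
      roughSum (suc q) M + sumTo (λ k → threeOver q * roughSum (suc q) (M /q^ k)) M ∎
      where
      open ≤-Reasoning
      multiples : ∀ k → sumTo (λ n → primePowerPart n k) M ≡ threeOver q * roughSum (suc q) (M /q^ k)
      multiples k = trans (sumTo-*ˡ (threeOver q) _ M)
                          (cong (threeOver q *_) (sumTo-multiples (roughPart (suc q)) (q ℕ.^ k) {{ℕ.m^n≢0 q k}} M))

module Weight (N-1 : ℕ) where

  open import Data.Nat as ℕ using (ℕ; zero; suc; NonZero; z≤n; s≤s)
  import Data.Nat.Properties as ℕ
  import Data.Integer as ℤ
  open import Data.Rational as ℚ using (ℚ; 0ℚ; 1ℚ; _+_; _*_; _-_; _≤_; 1/_; *≤*)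
  open import Data.Rational.Properties
  open import Data.Sum using (inj₁; inj₂)
  open import Relation.Binary.PropositionalEquality using (_≡_; refl; sym; trans; cong; cong₂; module ≡-Reasoning)
  open import Tactic.RingSolver using (solve-∀)
  open RationalLemmas

  N K : ℕ
  N = suc N-1
  K = 2 ℕ.* N

  factor : ℕ → ℚ
  factor j = 1ℚ + recip (K ℕ.* j)

  w : ℕ → ℚ
  w zero            = 1ℚ
  w (suc zero)      = 1ℚ
  w (suc n@(suc _)) = w n * factor (suc n)

  w-suc : ∀ n .{{_ : NonZero n}} → w (suc n) ≡ w n * factor (suc n)
  w-suc (suc n) = refl

  factor-≥1 : ∀ j → 1ℚ ≤ factor j
  factor-≥1 j = p≤p+q 1ℚ (recip-nonNeg (K ℕ.* j))

  factor-nonNeg : ∀ j → 0ℚ ≤ factor j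
  factor-nonNeg j = ≤-trans 0≤1 (factor-≥1 j)

  w-≥1 : ∀ n → 1ℚ ≤ w n
  w-≥1 zero            = ≤-refl
  w-≥1 (suc zero)      = ≤-refl
  w-≥1 (suc n@(suc _)) = *-mono-≤-0≤ 0≤1 0≤1 (w-≥1 n) (factor-≥1 (suc n))

  w-nonNeg : ∀ n → 0ℚ ≤ w n
  w-nonNeg n = ≤-trans 0≤1 (w-≥1 n)

  w-≤-suc : ∀ n → w n ≤ w (suc n)
  w-≤-suc zero          = ≤-refl
  w-≤-suc n@(suc _) = begin
    w n              ≡⟨ sym (*-identityʳ (w n)) ⟩
    w n * 1ℚ         ≤⟨ *-monoˡ-≤-0≤ (w-nonNeg n) (factor-≥1 (suc n)) ⟩
    w n * factor (suc n) ∎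
    where open ≤-Reasoning

  w-mono-≤ : ∀ {m n} → m ℕ.≤ n → w m ≤ w n
  w-mono-≤ {n = zero}  z≤n = ≤-refl
  w-mono-≤ {m} {suc n} m≤1+n with ℕ.m≤n⇒m<n∨m≡n m≤1+n
  ... | inj₂ refl  = ≤-refl
  ... | inj₁ m<1+n = ≤-trans (w-mono-≤ (ℕ.≤-pred m<1+n)) (w-≤-suc n)

  private
    w-positive : ∀ n → ℚ.Positive (w n)
    w-positive n = ℚ.positive (<-≤-trans (positive⁻¹ 1ℚ) (w-≥1 n))

    w≢0 : ∀ n → ℚ.NonZero (w n)
    w≢0 n = pos⇒nonZero (w n) {{w-positive n}}

  u : ℕ → ℚ
  u n = (1/ w n) {{w≢0 n}}

  w*u≡1 : ∀ n → w n * u n ≡ 1ℚ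
  w*u≡1 n = *-inverseʳ (w n) {{w≢0 n}}

  u-nonNeg : ∀ n → 0ℚ ≤ u n
  u-nonNeg n = nonNegative⁻¹ (u n) {{pos⇒nonNeg (u n) {{1/pos⇒pos (w n) {{w-positive n}}}}}}

  u-antitone : ∀ {m n} → m ℕ.≤ n → u n ≤ u m
  u-antitone {m} {n} m≤n = inverse-antitone (u-nonNeg m) (u-nonNeg n) (w*u≡1 m) (w*u≡1 n) (w-mono-≤ m≤n)

  u≡u[1+n]*factor : ∀ n .{{_ : NonZero n}} → u n ≡ u (suc n) * factor (suc n)
  u≡u[1+n]*factor n = inverse-unique (w n) (w*u≡1 n) (begin
    w n * (u (suc n) * factor (suc n)) ≡⟨ x∙yz≈xz∙y (w n) (u (suc n)) (factor (suc n)) ⟩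
    w n * factor (suc n) * u (suc n)   ≡⟨ cong (_* u (suc n)) (sym (w-suc n)) ⟩
    w (suc n) * u (suc n)              ≡⟨ w*u≡1 (suc n) ⟩
    1ℚ                                 ∎)
    where open ≡-Reasoning

  -- Each of the t factors after w a is at least 1 + 1/(K s); then Bernoulli.
  w-window : ∀ a t {s} .{{_ : NonZero a}} → t ℕ.+ a ℕ.≤ s → w a * (1ℚ + fromℕ t * recip (K ℕ.* s)) ≤ w (t ℕ.+ a)
  w-window a zero {s} _ = ≤-reflexive (trans (cong (λ c → w a * (1ℚ + c)) (*-zeroˡ (recip (K ℕ.* s)))) (*-identityʳ (w a)))
  w-window a (suc t) {s} 1+t+a≤s = begin
    w a * (1ℚ + fromℕ (suc t) * y)                 ≡⟨ cong (λ c → w a * (1ℚ + c * y)) (fromℕ-suc t) ⟩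
    w a * (1ℚ + (1ℚ + fromℕ t) * y)                ≤⟨ *-monoˡ-≤-0≤ (w-nonNeg a) (p≤p+q _ (*-nonNeg (*-nonNeg (fromℕ-nonNeg t) y-nonNeg) y-nonNeg)) ⟩
    w a * (1ℚ + (1ℚ + fromℕ t) * y + fromℕ t * y * y) ≡⟨ expand (w a) (fromℕ t) y ⟩
    w a * (1ℚ + fromℕ t * y) * (1ℚ + y)            ≤⟨ *-mono-≤-0≤ (*-nonNeg (w-nonNeg a) (+-nonNeg 0≤1 (*-nonNeg (fromℕ-nonNeg t) y-nonNeg))) (+-nonNeg 0≤1 y-nonNeg)
                                                         (w-window a t (ℕ.<⇒≤ 1+t+a≤s)) (+-monoʳ-≤ 1ℚ (recip-antitone (ℕ.*-monoʳ-≤ K 1+t+a≤s))) ⟩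
    w (t ℕ.+ a) * factor (suc (t ℕ.+ a))           ≡⟨ sym (w-suc (t ℕ.+ a) {{t+a≢0}}) ⟩
    w (suc t ℕ.+ a)                                ∎
    where
    open ≤-Reasoning
    y : ℚ
    y = recip (K ℕ.* s)
    y-nonNeg : 0ℚ ≤ y
    y-nonNeg = recip-nonNeg (K ℕ.* s)
    t+a≢0 : NonZero (t ℕ.+ a)
    t+a≢0 = ℕ.>-nonZero (ℕ.<-≤-trans (ℕ.>-nonZero⁻¹ a) (ℕ.m≤n+m a t))
    instance
      Ks≢0 : NonZero (K ℕ.* s)
      Ks≢0 = ℕ.m*n≢0 K s {{_}} {{ℕ.>-nonZero (ℕ.<-≤-trans (s≤s z≤n) 1+t+a≤s)}}
    expand : ∀ c n y → c * (1ℚ + (1ℚ + n) * y + n * y * y) ≡ c * (1ℚ + n * y) * (1ℚ + y)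
    expand = solve-∀ ℚ-ring

  w-supermultiplicative : ∀ m n .{{_ : NonZero m}} .{{_ : NonZero n}} → w m * w n ≤ w (m ℕ.* n)
  w-supermultiplicative (suc zero)      n = ≤-reflexive (trans (*-identityˡ (w n)) (cong w (sym (ℕ.+-identityʳ n))))
  w-supermultiplicative (suc m@(suc _)) n = begin
    w m * factor (suc m) * w n                         ≡⟨ xy∙z≈xz∙y (w m) (factor (suc m)) (w n) ⟩
    w m * w n * factor (suc m)                         ≤⟨ *-monoʳ-≤-0≤ (factor-nonNeg (suc m)) (w-supermultiplicative m n) ⟩
    w (m ℕ.* n) * (1ℚ + recip (K ℕ.* suc m))           ≡⟨ cong (λ c → w (m ℕ.* n) * (1ℚ + c)) recip-spread ⟩
    w (m ℕ.* n) * (1ℚ + fromℕ n * recip (K ℕ.* (n ℕ.+ m ℕ.* n))) ≤⟨ w-window (m ℕ.* n) n {{ℕ.m*n≢0 m n}} ℕ.≤-refl ⟩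
    w (n ℕ.+ m ℕ.* n)                                  ∎
    where
    open ≤-Reasoning
    recip-spread : recip (K ℕ.* suc m) ≡ fromℕ n * recip (K ℕ.* (suc m ℕ.* n))
    recip-spread = sym (trans (cong (λ j → fromℕ n * recip j) (sym (ℕ.*-assoc K (suc m) n)))
                              (n*recip[m*n]≡recip[m] (K ℕ.* suc m) n))

  w-^ : ∀ m k .{{_ : NonZero m}} → w m ^ℚ k ≤ w (m ℕ.^ k)
  w-^ m zero    = ≤-refl
  w-^ m (suc k) = ≤-trans (*-monoˡ-≤-0≤ (w-nonNeg m) (w-^ m k)) (w-supermultiplicative m (m ℕ.^ k))
    where
    instance
      m^k≢0 : NonZero (m ℕ.^ k)
      m^k≢0 = ℕ.m^n≢0 m k

  u-^ : ∀ m k .{{_ : NonZero m}} → u (m ℕ.^ k) ≤ u m ^ℚ k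
  u-^ m k = inverse-antitone (^ℚ-nonNeg k (u-nonNeg m)) (u-nonNeg (m ℕ.^ k)) w^k*u^k≡1 (w*u≡1 (m ℕ.^ k)) (w-^ m k)
    where
    w^k*u^k≡1 : w m ^ℚ k * u m ^ℚ k ≡ 1ℚ
    w^k*u^k≡1 = trans (sym (^ℚ-distrib-* (w m) (u m) k)) (trans (cong (_^ℚ k) (w*u≡1 m)) (1^ℚn≡1 k))

  w-≤-w*u : ∀ {d n M} .{{_ : NonZero d}} .{{_ : NonZero n}} → d ℕ.* n ℕ.≤ M → w n ≤ w M * u d
  w-≤-w*u {d} {n} {M} dn≤M = begin
    w n                  ≡⟨ sym (trans (cong (_* w n) (w*u≡1 d)) (*-identityˡ (w n))) ⟩
    w d * u d * w n      ≡⟨ xy∙z≈xz∙y (w d) (u d) (w n) ⟩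
    w d * w n * u d      ≤⟨ *-monoʳ-≤-0≤ (u-nonNeg d) (≤-trans (w-supermultiplicative d n) (w-mono-≤ dn≤M)) ⟩
    w M * u d            ∎
    where open ≤-Reasoning

  -- With N x = 1/(2j) for x = 1/(K j), the upper Bernoulli bound gives factor(j)^N ≤ 2j/(2j-1) ≤ j/(j-1).
  factor^N-≤ : ∀ m .{{_ : NonZero m}} → fromℕ m * factor (suc m) ^ℚ N ≤ fromℕ (suc m)
  factor^N-≤ m = begin
    fromℕ m * P                           ≤⟨ *-monoʳ-≤-0≤ (^ℚ-nonNeg N (factor-nonNeg j)) m≤j[1-Nx] ⟩
    fromℕ j * (1ℚ - fromℕ N * x) * P      ≡⟨ xy∙z≈x∙zy (fromℕ j) (1ℚ - fromℕ N * x) P ⟩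
    fromℕ j * (P * (1ℚ - fromℕ N * x))    ≤⟨ *-monoˡ-≤-0≤ (fromℕ-nonNeg j) (bernoulli-upper N (recip-nonNeg (K ℕ.* j))) ⟩
    fromℕ j * 1ℚ                          ≡⟨ *-identityʳ (fromℕ j) ⟩
    fromℕ j                               ∎
    where
    open ≤-Reasoning
    j : ℕ
    j = suc m
    x P : ℚ
    x = recip (K ℕ.* j)
    P = factor j ^ℚ N
    2*jNx≡1 : fromℕ 2 * (fromℕ j * (fromℕ N * x)) ≡ 1ℚ
    2*jNx≡1 = begin-equality
      fromℕ 2 * (fromℕ j * (fromℕ N * x))      ≡⟨ regroup (fromℕ 2) (fromℕ j) (fromℕ N) x ⟩
      fromℕ 2 * fromℕ N * fromℕ j * x          ≡⟨ cong (λ c → c * fromℕ j * x) (sym (fromℕ-* 2 N)) ⟩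
      fromℕ K * fromℕ j * x                    ≡⟨ cong (_* x) (sym (fromℕ-* K j)) ⟩
      fromℕ (K ℕ.* j) * x                      ≡⟨ fromℕ*recip (K ℕ.* j) ⟩
      1ℚ                                       ∎
      where
      regroup : ∀ a b c d → a * (b * (c * d)) ≡ a * c * b * d
      regroup = solve-∀ ℚ-ring
    jNx≡½ : fromℕ j * (fromℕ N * x) ≡ recip 2
    jNx≡½ = inverse-unique (fromℕ 2) 2*jNx≡1 (fromℕ*recip 2)
    m≤j[1-Nx] : fromℕ m ≤ fromℕ j * (1ℚ - fromℕ N * x)
    m≤j[1-Nx] = begin
      fromℕ m                                  ≡⟨ sym (cancel (fromℕ m)) ⟩
      1ℚ + fromℕ m - 1ℚ                        ≤⟨ +-monoʳ-≤ (1ℚ + fromℕ m) (neg-antimono-≤ ½≤1) ⟩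
      1ℚ + fromℕ m - recip 2                   ≡⟨ cong₂ _-_ (sym (fromℕ-suc m)) (sym jNx≡½) ⟩
      fromℕ j - fromℕ j * (fromℕ N * x)        ≡⟨ factorise (fromℕ j) (fromℕ N * x) ⟩
      fromℕ j * (1ℚ - fromℕ N * x)             ∎
      where
      ½≤1 : recip 2 ≤ 1ℚ
      ½≤1 = *≤* (ℤ.+≤+ (s≤s z≤n))
      cancel : ∀ a → 1ℚ + a - 1ℚ ≡ a
      cancel = solve-∀ ℚ-ring
      factorise : ∀ a b → a - a * b ≡ a * (1ℚ - b)
      factorise = solve-∀ ℚ-ring

  w^N-≤ : ∀ n .{{_ : NonZero n}} → w n ^ℚ N ≤ fromℕ n
  w^N-≤ (suc zero)      = ≤-reflexive (1^ℚn≡1 N)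
  w^N-≤ (suc n@(suc _)) = begin
    (w n * factor (suc n)) ^ℚ N         ≡⟨ ^ℚ-distrib-* (w n) (factor (suc n)) N ⟩
    w n ^ℚ N * factor (suc n) ^ℚ N      ≤⟨ *-monoʳ-≤-0≤ (^ℚ-nonNeg N (factor-nonNeg (suc n))) (w^N-≤ n) ⟩
    fromℕ n * factor (suc n) ^ℚ N       ≤⟨ factor^N-≤ n ⟩
    fromℕ (suc n)                       ∎
    where open ≤-Reasoning

  u-telescoping : ∀ p .{{_ : NonZero p}} → threeOver (suc p) * u (suc p) ≡ fromℕ (3 ℕ.* K) * (u p - u (suc p))
  u-telescoping p = begin
    threeOver (suc p) * u (suc p)                              ≡⟨ cong (_* u (suc p)) (threeOver-suc p) ⟩
    fromℕ 3 * recip (suc p) * u (suc p)                        ≡⟨ cong (λ r → fromℕ 3 * r * u (suc p)) recip[1+p]≡K*x ⟩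
    fromℕ 3 * (fromℕ K * x) * u (suc p)                        ≡⟨ regroup (fromℕ 3) (fromℕ K) x (u (suc p)) ⟩
    fromℕ 3 * fromℕ K * (u (suc p) * (1ℚ + x) - u (suc p))     ≡⟨ cong₂ (λ c v → c * (v - u (suc p))) (sym (fromℕ-* 3 K)) (sym (u≡u[1+n]*factor p)) ⟩
    fromℕ (3 ℕ.* K) * (u p - u (suc p))                        ∎
    where
    open ≡-Reasoning
    x : ℚ
    x = recip (K ℕ.* suc p)
    recip[1+p]≡K*x : recip (suc p) ≡ fromℕ K * x
    recip[1+p]≡K*x = sym (trans (cong (λ j → fromℕ K * recip j) (ℕ.*-comm K (suc p))) (n*recip[m*n]≡recip[m] (suc p) K))
    regroup : ∀ a b r v → a * (b * r) * v ≡ a * b * (v * (1ℚ + r) - v)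
    regroup = solve-∀ ℚ-ring

  u-geometric : ∀ {q} L → 2 ℕ.≤ q → sumTo (u q ^ℚ_) L ≤ fromℕ (K ℕ.* 2)
  u-geometric {q} L 2≤q = geometric-≤ L (u-nonNeg q) (fromℕ-nonNeg (K ℕ.* 2)) (begin
    u q * (1ℚ + c)                  ≤⟨ *-monoʳ-≤-0≤ (+-nonNeg 0≤1 (fromℕ-nonNeg (K ℕ.* 2))) (u-antitone 2≤q) ⟩
    u 2 * (1ℚ + c)                  ≡⟨ cong (u 2 *_) 1+c≡c*factor2 ⟩
    u 2 * (c * factor 2)            ≡⟨ rearrange (u 2) c (factor 2) ⟩
    c * (w 2 * u 2)                 ≡⟨ cong (c *_) (w*u≡1 2) ⟩
    c * 1ℚ                          ≡⟨ *-identityʳ c ⟩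
    c                               ∎)
    where
    open ≤-Reasoning
    c : ℚ
    c = fromℕ (K ℕ.* 2)
    1+c≡c*factor2 : 1ℚ + c ≡ c * factor 2
    1+c≡c*factor2 = begin-equality
      1ℚ + c                        ≡⟨ +-comm 1ℚ c ⟩
      c + 1ℚ                        ≡⟨ cong (c +_) (sym (fromℕ*recip (K ℕ.* 2))) ⟩
      c + c * recip (K ℕ.* 2)       ≡⟨ cong (_+ c * recip (K ℕ.* 2)) (sym (*-identityʳ c)) ⟩
      c * 1ℚ + c * recip (K ℕ.* 2)  ≡⟨ sym (*-distribˡ-+ c 1ℚ (recip (K ℕ.* 2))) ⟩
      c * factor 2                  ∎
    rearrange : ∀ a c f → a * (c * f) ≡ c * (1ℚ * f * a)
    rearrange = solve-∀ ℚ-ring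

  w-unbounded : ∀ B → fromℕ B ≤ w (2 ℕ.^ (K ℕ.* 2 ℕ.* B))
  w-unbounded B = begin
    fromℕ B                              ≤⟨ p≤q+p (fromℕ B) 0≤1 ⟩
    1ℚ + fromℕ B                         ≡⟨ cong (1ℚ +_) (sym t*x≡B) ⟩
    1ℚ + fromℕ t * x                     ≤⟨ bernoulli t (recip-nonNeg (K ℕ.* 2)) ⟩
    (1ℚ + x) ^ℚ t                        ≡⟨ cong (_^ℚ t) (sym (*-identityˡ (factor 2))) ⟩
    w 2 ^ℚ t                             ≤⟨ w-^ 2 t ⟩
    w (2 ℕ.^ t)                          ∎
    where
    open ≤-Reasoning
    t : ℕ
    t = K ℕ.* 2 ℕ.* B
    x : ℚ
    x = recip (K ℕ.* 2)
    t*x≡B : fromℕ t * x ≡ fromℕ B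
    t*x≡B = begin-equality
      fromℕ t * x                        ≡⟨ cong (_* x) (fromℕ-* (K ℕ.* 2) B) ⟩
      fromℕ (K ℕ.* 2) * fromℕ B * x      ≡⟨ xy∙z≈y∙xz (fromℕ (K ℕ.* 2)) (fromℕ B) x ⟩
      fromℕ B * (fromℕ (K ℕ.* 2) * x)    ≡⟨ cong (fromℕ B *_) (fromℕ*recip (K ℕ.* 2)) ⟩
      fromℕ B * 1ℚ                       ≡⟨ *-identityʳ (fromℕ B) ⟩
      fromℕ B                            ∎

  u-eventually-small : ∀ B → fromℕ B * u (2 ℕ.^ (K ℕ.* 2 ℕ.* B)) ≤ 1ℚ
  u-eventually-small B = ≤-trans (*-monoʳ-≤-0≤ (u-nonNeg Q) (w-unbounded B)) (≤-reflexive (w*u≡1 Q))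
    where Q = 2 ℕ.^ (K ℕ.* 2 ℕ.* B)

module Bounds (N-1 : ℕ) where

  open import Data.Nat as ℕ using (ℕ; zero; suc; NonZero; NonTrivial; z≤n; s≤s)
  import Data.Nat.Properties as ℕ
  import Data.Nat.DivMod as ℕ
  open import Data.Nat.Induction using (<-rec)
  open import Data.Rational as ℚ using (ℚ; 0ℚ; 1ℚ; _+_; _*_; _-_; _≤_)
  open import Data.Rational.Properties
  open import Relation.Binary.PropositionalEquality using (_≡_; refl; sym; trans; cong; subst)
  open import Relation.Nullary using (yes; no; contradiction)
  open import Tactic.RingSolver using (solve-∀)
  open RationalLemmas
  open Divisors
  open RoughSums

  open Weight N-1

  module _ (q : ℕ) .{{_ : NonTrivial q}} where

    open Recurrence q

    roughSum-quotient : ∀ r {A M} k .{{_ : NonZero k}} → 0ℚ ≤ A → (∀ x → x ℕ.< M → roughSum r x ≤ A * w x) →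
                        roughSum r (M /q^ k) ≤ A * w M * u q ^ℚ k
    roughSum-quotient r {A} {M} k 0≤A bound with M /q^ k in M/q^k≡x
    ... | zero  = *-nonNeg (*-nonNeg 0≤A (w-nonNeg M)) (^ℚ-nonNeg k (u-nonNeg q))
    ... | suc x = begin
      roughSum r (suc x)            ≤⟨ bound (suc x) 1+x<M ⟩
      A * w (suc x)                 ≤⟨ *-monoˡ-≤-0≤ 0≤A (w-≤-w*u {q ℕ.^ k} {suc x} q^k*[1+x]≤M) ⟩
      A * (w M * u (q ℕ.^ k))       ≤⟨ *-monoˡ-≤-0≤ 0≤A (*-monoˡ-≤-0≤ (w-nonNeg M) (u-^ q k)) ⟩
      A * (w M * u q ^ℚ k)          ≡⟨ sym (*-assoc A (w M) (u q ^ℚ k)) ⟩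
      A * w M * u q ^ℚ k            ∎
      where
      open ≤-Reasoning
      instance
        q^k≢0 : NonZero (q ℕ.^ k)
        q^k≢0 = ℕ.m^n≢0 q k
      [1+x]*q^k≤M : suc x ℕ.* q ℕ.^ k ℕ.≤ M
      [1+x]*q^k≤M = subst (λ y → y ℕ.* q ℕ.^ k ℕ.≤ M) M/q^k≡x (ℕ.m/n*n≤m M (q ℕ.^ k))
      q^k*[1+x]≤M : q ℕ.^ k ℕ.* suc x ℕ.≤ M
      q^k*[1+x]≤M = subst (ℕ._≤ M) (ℕ.*-comm (suc x) (q ℕ.^ k)) [1+x]*q^k≤M
      1+x<M : suc x ℕ.< M
      1+x<M = ℕ.<-≤-trans (ℕ.m<m*n (suc x) (q ℕ.^ k) (ℕ.≤-<-trans (ℕ.>-nonZero⁻¹ k) (n<q^n q k))) [1+x]*q^k≤M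

    roughSum-tail-≤ : ∀ r {A M} → 0ℚ ≤ A → (∀ x → x ℕ.< M → roughSum r x ≤ A * w x) →
             sumTo (λ k → threeOver q * roughSum r (M /q^ k)) M ≤ threeOver q * (A * w M) * sumTo (u q ^ℚ_) M
    roughSum-tail-≤ r {A} {M} 0≤A bound = begin
      sumTo (λ k → threeOver q * roughSum r (M /q^ k)) M   ≤⟨ sumTo-mono-≤ M (λ k _ → termwise k) ⟩
      sumTo (λ k → threeOver q * (A * w M) * u q ^ℚ k) M   ≡⟨ sumTo-*ˡ (threeOver q * (A * w M)) (u q ^ℚ_) M ⟩
      threeOver q * (A * w M) * sumTo (u q ^ℚ_) M          ∎
      where
      open ≤-Reasoning
      termwise : ∀ k .{{_ : NonZero k}} → threeOver q * roughSum r (M /q^ k) ≤ threeOver q * (A * w M) * u q ^ℚ k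
      termwise k = ≤-trans (*-monoˡ-≤-0≤ (threeOver-nonNeg q) (roughSum-quotient r k 0≤A bound))
                           (≤-reflexive (sym (*-assoc (threeOver q) (A * w M) (u q ^ℚ k))))

  -- B = 2 · 2 · 3K: the bound 2 w(M) for larger q, the geometric tail 2 u(q), and 3/q · u(q) = 3K (u(q-1) - u(q)).
  B Q₀ : ℕ
  B  = 4 ℕ.* (3 ℕ.* K)
  Q₀ = 2 ℕ.^ (K ℕ.* 2 ℕ.* B)

  B*u≤1 : ∀ {p} → Q₀ ℕ.≤ p → fromℕ B * u p ≤ 1ℚ
  B*u≤1 Q₀≤p = ≤-trans (*-monoˡ-≤-0≤ (fromℕ-nonNeg B) (u-antitone Q₀≤p)) (u-eventually-small B)

  2*u≤1 : ∀ {p} → Q₀ ℕ.≤ p → fromℕ 2 * u p ≤ 1ℚ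
  2*u≤1 {p} Q₀≤p = ≤-trans (*-monoʳ-≤-0≤ (u-nonNeg p) (fromℕ-mono-≤ 2≤B)) (B*u≤1 Q₀≤p)
    where
    2≤B : 2 ℕ.≤ B
    2≤B = ℕ.≤-trans (s≤s (s≤s z≤n)) (ℕ.m≤m*n 4 (3 ℕ.* K))

  LargeBound : ℕ → Set
  LargeBound M = ∀ q → Q₀ ℕ.< q → roughSum q M ≤ fromℕ 2 * w M

  module _ {M} (smaller : ∀ {x} → x ℕ.< M → LargeBound x) where

    -- Downward induction on p (t = M - p); each step costs B w(M) (u(p) - u(p+1)), which telescopes.
    roughSum-descent : ∀ t p → Q₀ ℕ.≤ p → t ℕ.+ p ≡ M → roughSum (suc p) M ≤ 1ℚ + fromℕ B * w M * (u p - u M)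
    roughSum-descent zero    p         _    refl = ≤-trans (roughSum-≤1 (suc p) p ℕ.≤-refl) (≤-reflexive (sym (cancel (fromℕ B * w p) (u p))))
      where
      cancel : ∀ c v → 1ℚ + c * (v - v) ≡ 1ℚ
      cancel = solve-∀ ℚ-ring
    roughSum-descent (suc t) zero      Q₀≤0 _    = contradiction Q₀≤0 (ℕ.<⇒≱ (ℕ.m^n>0 2 (K ℕ.* 2 ℕ.* B)))
    roughSum-descent (suc t) p@(suc _) Q₀≤p t+1+p≡M = begin
      roughSum q M                                   ≤⟨ Recurrence.roughSum-recurrence q M ⟩
      roughSum (suc q) M + T                         ≤⟨ +-mono-≤ (roughSum-descent t q (ℕ.m≤n⇒m≤1+n Q₀≤p) (trans (ℕ.+-suc t p) t+1+p≡M)) T≤ ⟩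
      1ℚ + X * (u q - u M) + X * (u p - u q)         ≡⟨ telescope 1ℚ X (u p) (u q) (u M) ⟩
      1ℚ + X * (u p - u M)                           ∎
      where
      open ≤-Reasoning
      open Recurrence (suc p) using (_/q^_)
      q : ℕ
      q = suc p
      X T : ℚ
      X = fromℕ B * w M
      T = sumTo (λ k → threeOver q * roughSum (suc q) (M /q^ k)) M
      Q₀≤q : Q₀ ℕ.≤ q
      Q₀≤q = ℕ.m≤n⇒m≤1+n Q₀≤p
      telescope : ∀ o x a b c → o + x * (b - c) + x * (a - b) ≡ o + x * (a - c)
      telescope = solve-∀ ℚ-ring
      regroup : ∀ t w u → t * (fromℕ 2 * w) * (fromℕ 2 * u) ≡ fromℕ 2 * fromℕ 2 * w * (t * u)
      regroup = solve-∀ ℚ-ring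
      regroup′ : ∀ a w c d → a * w * (c * d) ≡ a * c * w * d
      regroup′ = solve-∀ ℚ-ring
      2*2*3K≡B : fromℕ 2 * fromℕ 2 * fromℕ (3 ℕ.* K) ≡ fromℕ B
      2*2*3K≡B = sym (trans (fromℕ-* 4 (3 ℕ.* K)) (cong (_* fromℕ (3 ℕ.* K)) (fromℕ-* 2 2)))
      T≤ : T ≤ X * (u p - u q)
      T≤ = begin
        T                                                         ≤⟨ roughSum-tail-≤ q (suc q) (fromℕ-nonNeg 2) (λ x x<M → smaller x<M (suc q) (s≤s Q₀≤q)) ⟩
        threeOver q * (fromℕ 2 * w M) * sumTo (u q ^ℚ_) M         ≤⟨ *-monoˡ-≤-0≤ (*-nonNeg (threeOver-nonNeg q) (*-nonNeg (fromℕ-nonNeg 2) (w-nonNeg M)))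
                                                                       (geometric-≤-2x M (u-nonNeg q) (2*u≤1 Q₀≤q)) ⟩
        threeOver q * (fromℕ 2 * w M) * (fromℕ 2 * u q)           ≡⟨ regroup (threeOver q) (w M) (u q) ⟩
        fromℕ 2 * fromℕ 2 * w M * (threeOver q * u q)             ≡⟨ cong (fromℕ 2 * fromℕ 2 * w M *_) (u-telescoping p) ⟩
        fromℕ 2 * fromℕ 2 * w M * (fromℕ (3 ℕ.* K) * (u p - u q)) ≡⟨ regroup′ (fromℕ 2 * fromℕ 2) (w M) (fromℕ (3 ℕ.* K)) (u p - u q) ⟩
        fromℕ 2 * fromℕ 2 * fromℕ (3 ℕ.* K) * w M * (u p - u q)   ≡⟨ cong (λ c → c * w M * (u p - u q)) 2*2*3K≡B ⟩
        X * (u p - u q)                                           ∎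

  1+B*w*[u-u]≤2w : ∀ M {p} → Q₀ ℕ.≤ p → 1ℚ + fromℕ B * w M * (u p - u M) ≤ fromℕ 2 * w M
  1+B*w*[u-u]≤2w M {p} Q₀≤p = begin
    1ℚ + fromℕ B * w M * (u p - u M)                        ≡⟨ cong (1ℚ +_) (expand (fromℕ B) (w M) (u p) (u M)) ⟩
    1ℚ + (w M * (fromℕ B * u p) - fromℕ B * w M * u M)      ≤⟨ +-monoʳ-≤ 1ℚ (p-q≤p (w M * (fromℕ B * u p)) (*-nonNeg (*-nonNeg (fromℕ-nonNeg B) (w-nonNeg M)) (u-nonNeg M))) ⟩
    1ℚ + w M * (fromℕ B * u p)                              ≤⟨ +-mono-≤ (w-≥1 M) (*-monoˡ-≤-0≤ (w-nonNeg M) (B*u≤1 Q₀≤p)) ⟩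
    w M + w M * 1ℚ                                          ≡⟨ double (w M) ⟩
    fromℕ 2 * w M                                           ∎
    where
    open ≤-Reasoning
    expand : ∀ b w x y → b * w * (x - y) ≡ w * (b * x) - b * w * y
    expand = solve-∀ ℚ-ring
    double : ∀ y → y + y * 1ℚ ≡ fromℕ 2 * y
    double = solve-∀ ℚ-ring

  roughSum-large : ∀ M → LargeBound M
  roughSum-large = <-rec LargeBound bound
    where
    bound : ∀ M → (∀ {x} → x ℕ.< M → LargeBound x) → LargeBound M
    bound M smaller (suc p) (s≤s Q₀≤p) with p ℕ.≤? M
    ... | yes p≤M = ≤-trans (roughSum-descent smaller (M ℕ.∸ p) p Q₀≤p (ℕ.m∸n+n≡m p≤M)) (1+B*w*[u-u]≤2w M Q₀≤p)
    ... | no p≰M  = ≤-trans (roughSum-≤1 (suc p) M (ℕ.m<n⇒m<1+n (ℕ.≰⇒> p≰M))) 1≤2w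
      where
      1≤2w : 1ℚ ≤ fromℕ 2 * w M
      1≤2w = ≤-trans (w-≥1 M) (≤-trans (≤-reflexive (sym (*-identityˡ (w M)))) (*-monoʳ-≤-0≤ (w-nonNeg M) (fromℕ-mono-≤ (s≤s z≤n))))

  -- Below Q₀ every step down in q costs a factor 1 + 3 · 2K (3/q ≤ 3, and the geometric tail is at most 2K).
  A : ℕ → ℕ
  A zero    = 2
  A (suc t) = A t ℕ.* (1 ℕ.+ 3 ℕ.* (K ℕ.* 2))

  roughSum-small : ∀ t q → 2 ℕ.≤ q → t ℕ.+ q ≡ suc Q₀ → ∀ M → roughSum q M ≤ fromℕ (A t) * w M
  roughSum-small zero    q                _   refl M = roughSum-large M (suc Q₀) ℕ.≤-refl
  roughSum-small (suc t) (suc zero)       (s≤s ()) _ _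
  roughSum-small (suc t) q@(suc (suc _)) 2≤q t+1+q≡1+Q₀ M = begin
    roughSum q M                                    ≤⟨ Recurrence.roughSum-recurrence q M ⟩
    roughSum (suc q) M + T                          ≤⟨ +-mono-≤ (previous M) T≤ ⟩
    a * w M + fromℕ 3 * (a * w M) * c               ≡⟨ regroup a (w M) (fromℕ 3) c ⟩
    a * (1ℚ + fromℕ 3 * c) * w M                    ≡⟨ cong (_* w M) (sym A[1+t]≡) ⟩
    fromℕ (A (suc t)) * w M                         ∎
    where
    open ≤-Reasoning
    open Recurrence q using (_/q^_)
    a c T : ℚ
    a = fromℕ (A t)
    c = fromℕ (K ℕ.* 2)
    T = sumTo (λ k → threeOver q * roughSum (suc q) (M /q^ k)) M
    previous : ∀ x → roughSum (suc q) x ≤ a * w x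
    previous = roughSum-small t (suc q) (ℕ.m≤n⇒m≤1+n 2≤q) (trans (ℕ.+-suc t q) t+1+q≡1+Q₀)
    aw-nonNeg : 0ℚ ≤ a * w M
    aw-nonNeg = *-nonNeg (fromℕ-nonNeg (A t)) (w-nonNeg M)
    T≤ : T ≤ fromℕ 3 * (a * w M) * c
    T≤ = begin
      T                                        ≤⟨ roughSum-tail-≤ q (suc q) {M = M} (fromℕ-nonNeg (A t)) (λ x _ → previous x) ⟩
      threeOver q * (a * w M) * sumTo (u q ^ℚ_) M ≤⟨ *-monoˡ-≤-0≤ (*-nonNeg (threeOver-nonNeg q) aw-nonNeg) (u-geometric M 2≤q) ⟩
      threeOver q * (a * w M) * c              ≤⟨ *-monoʳ-≤-0≤ (fromℕ-nonNeg (K ℕ.* 2)) (*-monoʳ-≤-0≤ aw-nonNeg (threeOver-≤3 q)) ⟩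
      fromℕ 3 * (a * w M) * c                  ∎
    A[1+t]≡ : fromℕ (A (suc t)) ≡ a * (1ℚ + fromℕ 3 * c)
    A[1+t]≡ = begin-equality
      fromℕ (A (suc t))                              ≡⟨ fromℕ-* (A t) _ ⟩
      a * fromℕ (1 ℕ.+ 3 ℕ.* (K ℕ.* 2))              ≡⟨ cong (a *_) (trans (fromℕ-suc _) (cong (1ℚ +_) (fromℕ-* 3 (K ℕ.* 2)))) ⟩
      a * (1ℚ + fromℕ 3 * c)                         ∎
    regroup : ∀ a w t c → a * w + t * (a * w) * c ≡ a * (1ℚ + t * c) * w
    regroup = solve-∀ ℚ-ring

  C : ℕ
  C = A (Q₀ ℕ.∸ 1)

  S-≤ : ∀ M → S M ≤ fromℕ C * w M
  S-≤ M = ≤-trans (≤-reflexive (S≡roughSum-2 M)) (roughSum-small (Q₀ ℕ.∸ 1) 2 ℕ.≤-refl 1+Q₀ M)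
    where
    1+Q₀ : Q₀ ℕ.∸ 1 ℕ.+ 2 ≡ suc Q₀
    1+Q₀ = trans (ℕ.+-comm (Q₀ ℕ.∸ 1) 2) (cong suc (ℕ.m+[n∸m]≡n (ℕ.m^n>0 2 (K ℕ.* 2 ℕ.* B))))

open import Data.Nat as ℕ using (suc; _≤_)
open import Data.Integer using (+_)
open import Data.Product using (∃-syntax; _,_)
open import Data.Rational as ℚ using (0ℚ)
open import Data.Rational.Properties using (module ≤-Reasoning)
open import Relation.Binary.PropositionalEquality using (sym; cong₂)
open RationalLemmas
open RoughSums

lemma6p4 : (a b : ℕ) → ∃[ C ] ((M : ℕ) → 1 ≤ M →
             (S M ^ℚ suc b) ℚ.≤ ((+ C ℚ./ 1) ^ℚ suc b) ℚ.* ((+ M ℚ./ 1) ^ℚ suc a))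
lemma6p4 a b = C , λ M 1≤M → begin
  S M ^ℚ suc b                                  ≤⟨ ^ℚ-mono-≤ (suc b) (S-nonNeg M) (S-≤ M) ⟩
  (fromℕ C ℚ.* w M) ^ℚ suc b                    ≡⟨ ^ℚ-distrib-* (fromℕ C) (w M) (suc b) ⟩
  fromℕ C ^ℚ suc b ℚ.* w M ^ℚ suc b             ≤⟨ *-monoˡ-≤-0≤ C^N-nonNeg (w^N-≤ M {{ℕ.>-nonZero 1≤M}}) ⟩
  fromℕ C ^ℚ suc b ℚ.* fromℕ M                  ≤⟨ *-monoˡ-≤-0≤ C^N-nonNeg (1≤x⇒x≤x^ℚ[1+n] a (fromℕ-mono-≤ 1≤M)) ⟩
  fromℕ C ^ℚ suc b ℚ.* fromℕ M ^ℚ suc a         ≡⟨ sym (cong₂ (λ c m → c ^ℚ suc b ℚ.* m ^ℚ suc a) (n/1≡fromℕ C) (n/1≡fromℕ M)) ⟩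
  (+ C ℚ./ 1) ^ℚ suc b ℚ.* (+ M ℚ./ 1) ^ℚ suc a ∎
  where
  open ≤-Reasoning
  open Bounds b
  open Weight b
  C^N-nonNeg : 0ℚ ℚ.≤ fromℕ C ^ℚ suc b
  C^N-nonNeg = ^ℚ-nonNeg (suc b) (fromℕ-nonNeg C)
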